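{- Let $q$ be a power of an odd prime with $q\equiv 7\pmod 8$, and $F=F_{2,\frac13}(x)=x^2\big(1+\frac13\eta(x)\big)$. For any $b\in\mathbb{F}_q$, $\#A_{01}(b)$ and $\#A_{10}(b)$ cannot both be nonzero.
   Context: $\eta$ is the quadratic character of $\mathbb{F}_q$ ($\eta(0)=0$, $\eta=1$ on nonzero squares, $-1$ on non-squares). $C_{01}=\{x:\eta(x)=1,\eta(x+1)=-1\}$, $C_{10}=\{x:\eta(x)=-1,\eta(x+1)=1\}$, and $A_{ij}(b)=\{x\in C_{ij}: F(x+1)-F(x)=b\}$. -}

module Defs where

open import Level using (0ℓ)
open import Data.Nat using (ℕ; suc; _%_; _^_; _≤_)
open import Data.Nat.Primality using (Prime)
open import Data.Integer as ℤ using (ℤ; +_; -[1+_])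
import Data.Integer.Properties as ℤP
open import Data.Fin using (Fin)
open import Data.Fin.Properties using (any?)
open import Data.List using (List; length; filter; allFin)
open import Data.Product using (Σ; ∃; _×_; _,_)
open import Relation.Nullary using (¬_; Dec; yes; no)
open import Relation.Nullary.Decidable using (_×-dec_)
open import Relation.Binary.PropositionalEquality using (_≡_; _≢_; trans; sym; cong)
open import Relation.Binary.Definitions using (DecidableEquality)
import Algebra.Structures
open import Function.Bundles using (_↔_; Inverse)

-- A finite field with q elements, with propositional equality.
-- The inverse is total (with an arbitrary value at 0); the law is only
-- required for nonzero elements.
record FiniteField (q : ℕ) : Set₁ where
  infixl 6 _+_ _-_
  infixl 7 _*_
  field
    Carrier : Set
    _+_ _*_ : Carrier → Carrier → Carrier
    -_      : Carrier → Carrier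
    0# 1#   : Carrier
    _⁻¹     : Carrier → Carrier
    isCommutativeRing :
      Algebra.Structures.IsCommutativeRing {A = Carrier} _≡_ _+_ _*_ -_ 0# 1#
    0≢1     : 0# ≢ 1#
    ⁻¹-inverse : ∀ x → x ≢ 0# → x * (x ⁻¹) ≡ 1#
    enum    : Carrier ↔ Fin q

  _-_ : Carrier → Carrier → Carrier
  x - y = x + (- y)

  _≟_ : DecidableEquality Carrier
  x ≟ y with Data.Fin._≟_ (Inverse.to enum x) (Inverse.to enum y)
  ... | yes p = yes (trans (sym (Inverse.strictlyInverseʳ enum x))
                     (trans (cong (Inverse.from enum) p) (Inverse.strictlyInverseʳ enum y)))
  ... | no ¬p = no λ { _≡_.refl → ¬p _≡_.refl }

  elem : Fin q → Carrier
  elem = Inverse.from enum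

  IsSquare : Carrier → Set
  IsSquare x = ∃ λ y → y * y ≡ x

  isSquare? : ∀ x → Dec (IsSquare x)
  isSquare? x with any? (λ i → (elem i * elem i) ≟ x)
  ... | yes (i , p) = yes (elem i , p)
  ... | no ¬p = no λ { (y , p) → ¬p (Inverse.to enum y , subst′ p) }
    where
    subst′ : ∀ {y} → y * y ≡ x → elem (Inverse.to enum y) * elem (Inverse.to enum y) ≡ x
    subst′ {y} p rewrite Inverse.strictlyInverseʳ enum y = p

  η : Carrier → ℤ
  η x with x ≟ 0#
  ... | yes _ = + 0
  ... | no _ with isSquare? x
  ...   | yes _ = + 1
  ...   | no _  = -[1+ 0 ]

  ηF : Carrier → Carrier
  ηF x with x ≟ 0#
  ... | yes _ = 0#
  ... | no _ with isSquare? x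
  ...   | yes _ = 1#
  ...   | no _  = - 1#

  3# : Carrier
  3# = 1# + 1# + 1#

  F : Carrier → Carrier
  F x = x * x * (1# + (3# ⁻¹) * ηF x)

  C₀₁ : Carrier → Set
  C₀₁ x = η x ≡ + 1 × η (x + 1#) ≡ -[1+ 0 ]

  C₁₀ : Carrier → Set
  C₁₀ x = η x ≡ -[1+ 0 ] × η (x + 1#) ≡ + 1

  A₀₁ : Carrier → Carrier → Set
  A₀₁ b x = C₀₁ x × F (x + 1#) - F x ≡ b

  A₁₀ : Carrier → Carrier → Set
  A₁₀ b x = C₁₀ x × F (x + 1#) - F x ≡ b

  A₀₁? : ∀ b x → Dec (A₀₁ b x)
  A₀₁? b x = ((η x ℤP.≟ + 1) ×-dec (η (x + 1#) ℤP.≟ -[1+ 0 ])) ×-dec ((F (x + 1#) - F x) ≟ b)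

  A₁₀? : ∀ b x → Dec (A₁₀ b x)
  A₁₀? b x = ((η x ℤP.≟ -[1+ 0 ]) ×-dec (η (x + 1#) ℤP.≟ + 1)) ×-dec ((F (x + 1#) - F x) ≟ b)

  #A₀₁ : Carrier → ℕ
  #A₀₁ b = length (filter (λ i → A₀₁? b (elem i)) (allFin q))

  #A₁₀ : Carrier → ℕ
  #A₁₀ b = length (filter (λ i → A₁₀? b (elem i)) (allFin q))

IsOddPrimePower : ℕ → Set
IsOddPrimePower q = ∃ λ p → ∃ λ k → Prime p × p % 2 ≡ 1 × 1 ≤ k × q ≡ p ^ k

-- Write c = 1/3. For x ∈ C₀₁ and y ∈ C₁₀ the differences F(x+1) − F(x) and F(y+1) − F(y) are
-- explicit quadratics, and their equality puts (x, y) on the conic x² − 2x + y² + 4y + 1 = 0. On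
-- that conic (x − 1)² = −y(y + 4) and (x + y + 3)² = 2(x + 1)(y + 4), so
-- ((x − 1)(x + y + 3))² = (−y)(x + 1) · 2(y + 4)². For q ≡ 7 (mod 8), −1 is a non-residue and 2 a
-- residue, so −y is a residue, x + 1 is not, and the right-hand side is a non-square unless y = −4;
-- but then x = 1 and x + 1 = 2 is a square.
--
-- The facts about quadratic residues (half of 𝔽q× are squares, the product of two non-residues is a
-- square, and the characters of −1 and 2) are obtained by counting: the involutions x ↦ x + 1,
-- x ↦ −x, x ↦ 1/x and x ↦ −(x + 1) pair up elements, and parities are read off from
-- q = 2h + 1, h = 2j + 1, j = 2k + 1.

module Submission where

open import Defs
open import Level using (0ℓ)
open import Data.Nat as ℕ using (ℕ; zero; suc; _≤_; _<_; z≤n; s≤s; _%_; _/_)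
import Data.Nat.Properties as ℕP
open import Data.Nat.DivMod using (m≡m%n+[m/n]*n)
open import Data.Nat.Tactic.RingSolver using (solve-∀)
import Data.Integer as ℤ
import Data.Integer.Properties as ℤP
open import Data.Sign as Sign using (Sign)
open import Data.Maybe using (Maybe; just; nothing)
open import Data.Fin using (toℕ)
open import Data.Fin.Properties using (toℕ-injective; any?)
open import Data.List using (List; []; _∷_; length; filter; map; allFin)
open import Data.List.Properties using (filter-≐; filter-none; filter-all; length-map; length-tabulate)
open import Data.List.Membership.Propositional using (_∈_; lose)
open import Data.List.Membership.Propositional.Properties using (∈-filter⁺; ∈-filter⁻; ∈-map⁺; ∈-allFin)
open import Data.List.Relation.Unary.Any as Any using (here; there; satisfied)
import Data.List.Relation.Unary.All as All
open import Data.List.Relation.Unary.Unique.Propositional using (Unique)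
open import Data.List.Relation.Unary.AllPairs using (_∷_)
import Data.List.Relation.Unary.Unique.Propositional.Properties as Unique
open import Data.Empty using (⊥)
open import Data.Product using (∃-syntax; _×_; _,_; proj₁; proj₂)
open import Data.Sum using (_⊎_; inj₁; inj₂; [_,_]′)
open import Data.Unit using (tt)
open import Function.Base using (_∘_)
open import Function.Bundles using (Inverse)
open import Relation.Nullary using (¬_; Dec; yes; no; contradiction; ¬?)
open import Relation.Nullary.Decidable using (_×-dec_)
open import Relation.Unary using (Pred; Decidable; _⊆_)
open import Relation.Unary.Properties using (U?; U-Universal; _∩?_; _∪?_; ∁?)
open import Relation.Binary.Definitions using (DecidableEquality)
open import Relation.Binary.PropositionalEquality
open import Algebra.Bundles using (CommutativeRing)
open import Algebra.Structures using (IsCommutativeRing)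
import Algebra.Solver.Ring
open import Algebra.Solver.Ring.AlmostCommutativeRing
  using (_-Raw-AlmostCommutative⟶_; fromCommutativeRing)

length-filter-none : ∀ {A : Set} {P : Pred A 0ℓ} (P? : Decidable P) → (∀ x → ¬ P x) →
  ∀ xs → length (filter P? xs) ≡ 0
length-filter-none P? ¬P xs = cong length (filter-none P? (All.universal ¬P xs))

module Counting {C : Set} (_≟_ : DecidableEquality C) (elements : List C)
                (elements-unique : Unique elements) (∈-elements : ∀ x → x ∈ elements) where

  private
    remove : ∀ {z} (ys : List C) → z ∈ ys → List C
    remove (y ∷ ys) (here _)  = ys
    remove (y ∷ ys) (there p) = y ∷ remove ys p

    length-remove : ∀ {z} (ys : List C) (p : z ∈ ys) → length ys ≡ suc (length (remove ys p))
    length-remove (y ∷ ys) (here _)  = refl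
    length-remove (y ∷ ys) (there p) = cong suc (length-remove ys p)

    ∈-remove : ∀ {z w} (ys : List C) (p : z ∈ ys) → w ∈ ys → w ≢ z → w ∈ remove ys p
    ∈-remove (y ∷ ys) (here refl) (here refl) w≢z = contradiction refl w≢z
    ∈-remove (y ∷ ys) (here refl) (there q)   w≢z = q
    ∈-remove (y ∷ ys) (there p)   (here w≡y)  w≢z = here w≡y
    ∈-remove (y ∷ ys) (there p)   (there q)   w≢z = there (∈-remove ys p q w≢z)

  length-≤-injective : ∀ {xs ys : List C} → Unique xs → (f : C → C) →
    (∀ {x} → x ∈ xs → f x ∈ ys) →
    (∀ {x y} → x ∈ xs → y ∈ xs → f x ≡ f y → x ≡ y) →
    length xs ≤ length ys
  length-≤-injective {[]}     _            f maps inj = z≤n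
  length-≤-injective {x ∷ xs} {ys} (x∉xs ∷ xs-unique) f maps inj =
    subst (suc (length xs) ≤_) (sym (length-remove ys fx∈ys))
      (s≤s (length-≤-injective xs-unique f maps′ (λ p q → inj (there p) (there q))))
    where
    fx∈ys = maps (here refl)
    maps′ : ∀ {y} → y ∈ xs → f y ∈ remove ys fx∈ys
    maps′ y∈xs = ∈-remove ys fx∈ys (maps (there y∈xs))
      (λ fy≡fx → All.lookup x∉xs y∈xs (sym (inj (there y∈xs) (here refl) fy≡fx)))

  count : {P : Pred C 0ℓ} → Decidable P → ℕ
  count P? = length (filter P? elements)

  private
    filter-∈⇒ : {P : Pred C 0ℓ} (P? : Decidable P) → ∀ {x} → x ∈ filter P? elements → P x
    filter-∈⇒ P? x∈ = proj₂ (∈-filter⁻ P? {xs = elements} x∈)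

  module _ {P Q : Pred C 0ℓ} (P? : Decidable P) (Q? : Decidable Q) where

    count-≤-injective : (f : C → C) → (∀ {x} → P x → Q (f x)) →
      (∀ {x y} → P x → P y → f x ≡ f y → x ≡ y) → count P? ≤ count Q?
    count-≤-injective f maps inj =
      length-≤-injective (Unique.filter⁺ P? elements-unique) f
        (λ x∈ → ∈-filter⁺ Q? (∈-elements _) (maps (filter-∈⇒ P? x∈)))
        (λ x∈ y∈ → inj (filter-∈⇒ P? x∈) (filter-∈⇒ P? y∈))

    count-cong : P ⊆ Q → Q ⊆ P → count P? ≡ count Q?
    count-cong P⊆Q Q⊆P = cong length (filter-≐ P? Q? (P⊆Q , Q⊆P) elements)

  count-bijective : {P Q : Pred C 0ℓ} (P? : Decidable P) (Q? : Decidable Q) (f g : C → C) →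
    (∀ {x} → P x → Q (f x)) → (∀ {x y} → P x → P y → f x ≡ f y → x ≡ y) →
    (∀ {x} → Q x → P (g x)) → (∀ {x y} → Q x → Q y → g x ≡ g y → x ≡ y) →
    count P? ≡ count Q?
  count-bijective P? Q? f g f-maps f-inj g-maps g-inj = ℕP.≤-antisym
    (count-≤-injective P? Q? f f-maps f-inj) (count-≤-injective Q? P? g g-maps g-inj)

  count-split : {P R : Pred C 0ℓ} (P? : Decidable P) (R? : Decidable R) →
    count P? ≡ count (P? ∩? R?) ℕ.+ count (P? ∩? ∁? R?)
  count-split {P} {R} P? R? = go elements
    where
    go : ∀ xs → length (filter P? xs) ≡
                length (filter (P? ∩? R?) xs) ℕ.+ length (filter (P? ∩? ∁? R?) xs)
    go [] = refl
    go (x ∷ xs) with P? x | R? x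
    ... | yes _ | yes _ = cong suc (go xs)
    ... | yes _ | no _  = trans (cong suc (go xs)) (sym (ℕP.+-suc _ _))
    ... | no _  | yes _ = go xs
    ... | no _  | no _  = go xs

  module _ {P : Pred C 0ℓ} (P? : Decidable P) where

    count-positive : ∀ {x} → P x → 1 ≤ count P?
    count-positive {x} Px with filter P? elements | ∈-filter⁺ P? (∈-elements x) Px
    ... | _ ∷ _ | _ = s≤s z≤n

    empty⇒count≡0 : (∀ x → ¬ P x) → count P? ≡ 0
    empty⇒count≡0 ¬P = length-filter-none P? ¬P elements

    count-singleton : ∀ {a} → P a → (∀ {x} → P x → x ≡ a) → count P? ≡ 1
    count-singleton {a} Pa only-a = ℕP.≤-antisym
      (length-≤-injective {ys = a ∷ []} (Unique.filter⁺ P? elements-unique) (λ x → x)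
        (λ x∈ → here (only-a (filter-∈⇒ P? x∈))) (λ _ _ x≡y → x≡y))
      (count-positive Pa)

  count-≤-injective⇒surjective : {P Q : Pred C 0ℓ} (P? : Decidable P) (Q? : Decidable Q) (f : C → C) →
    (∀ {x} → P x → Q (f x)) → (∀ {x y} → P x → P y → f x ≡ f y → x ≡ y) →
    count Q? ≤ count P? → ∀ {y} → Q y → ∃[ x ] P x × f x ≡ y
  count-≤-injective⇒surjective {P} {Q} P? Q? f maps inj Q≤P {y} Qy
    with Any.any? (λ x → P? x ×-dec (f x ≟ y)) elements
  ... | yes preimage = satisfied preimage
  ... | no no-preimage = contradiction (ℕP.≤-trans Q≤P P≤Q-y) (ℕP.<⇒≱ Q-y<Q)
    where
    P≤Q-y : count P? ≤ count (Q? ∩? ∁? (_≟ y))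
    P≤Q-y = count-≤-injective P? (Q? ∩? ∁? (_≟ y)) f
      (λ {x} Px → maps Px , λ fx≡y → no-preimage (lose (∈-elements x) (Px , fx≡y)))
      inj
    Q-y<Q : count (Q? ∩? ∁? (_≟ y)) < count Q?
    Q-y<Q = subst (count (Q? ∩? ∁? (_≟ y)) <_)
      (trans (cong (ℕ._+ count (Q? ∩? ∁? (_≟ y))) (sym (count-singleton (Q? ∩? (_≟ y)) (Qy , refl) proj₂)))
             (sym (count-split Q? (_≟ y))))
      ℕP.≤-refl

  module Involution (index : C → ℕ)
                    (index-injective : ∀ {x y} → index x ≡ index y → x ≡ y)
                    (σ : C → C) where

    Fixed : Pred C 0ℓ
    Fixed x = σ x ≡ x

    fixed? : Decidable Fixed
    fixed? x = σ x ≟ x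

    -- Each orbit {x, σ x} of size two is counted once, through its element of smaller index.
    Lower : Pred C 0ℓ
    Lower x = index x < index (σ x)

    lower? : Decidable Lower
    lower? x = index x ℕP.<? index (σ x)

    count-involution : {P : Pred C 0ℓ} (P? : Decidable P) →
      (∀ {x} → P x → P (σ x)) → (∀ {x} → P x → σ (σ x) ≡ x) →
      count P? ≡ 2 ℕ.* count (P? ∩? lower?) ℕ.+ count (P? ∩? fixed?)
    count-involution {P} P? σ-closed σ-involutive = begin
      count P?                                    ≡⟨ count-split P? lower? ⟩
      k ℕ.+ count (P? ∩? ∁? lower?)               ≡⟨ cong (k ℕ.+_) (count-split (P? ∩? ∁? lower?) higher?) ⟩
      k ℕ.+ (count higher ℕ.+ count neither)      ≡⟨ cong₂ (λ a b → k ℕ.+ (a ℕ.+ b)) (sym lower≡higher) neither≡fixed ⟩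
      k ℕ.+ (k ℕ.+ f)                             ≡⟨ ℕP.+-assoc k k f ⟨
      k ℕ.+ k ℕ.+ f                               ≡⟨ cong (λ z → k ℕ.+ z ℕ.+ f) (ℕP.+-identityʳ k) ⟨
      2 ℕ.* k ℕ.+ f                               ∎
      where
      open ≡-Reasoning
      k = count (P? ∩? lower?)
      f = count (P? ∩? fixed?)
      higher? : Decidable (λ x → index (σ x) < index x)
      higher? x = index (σ x) ℕP.<? index x
      higher  = (P? ∩? ∁? lower?) ∩? higher?
      neither = (P? ∩? ∁? lower?) ∩? ∁? higher?
      σ-injective : ∀ {x y} → P x → P y → σ x ≡ σ y → x ≡ y
      σ-injective Px Py σx≡σy = trans (sym (σ-involutive Px)) (trans (cong σ σx≡σy) (σ-involutive Py))
      lower≡higher : k ≡ count higher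
      lower≡higher = count-bijective (P? ∩? lower?) higher σ σ
        (λ { {x} (Px , x<σx) →
             let σσx≡x = σ-involutive Px in
             (σ-closed Px , λ σx<σσx → ℕP.<-asym x<σx (subst (λ z → index (σ x) < index z) σσx≡x σx<σσx))
             , subst (λ z → index z < index (σ x)) (sym σσx≡x) x<σx })
        (λ (Px , _) (Py , _) → σ-injective Px Py)
        (λ { {x} ((Px , _) , σx<x) →
             σ-closed Px , subst (λ z → index (σ x) < index z) (sym (σ-involutive Px)) σx<x })
        (λ ((Px , _) , _) ((Py , _) , _) → σ-injective Px Py)
      neither≡fixed : count neither ≡ count (P? ∩? fixed?)
      neither≡fixed = count-cong neither (P? ∩? fixed?)
        (λ ((Px , x≮σx) , σx≮x) → Px , sym (index-injective (ℕP.≤-antisym (ℕP.≮⇒≥ σx≮x) (ℕP.≮⇒≥ x≮σx))))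
        (λ (Px , σx≡x) → (Px , λ x<σx → ℕP.<-irrefl (cong index (sym σx≡x)) x<σx)
                       , λ σx<x → ℕP.<-irrefl (cong index σx≡x) σx<x)

    count-involution-fixedPointFree : {P : Pred C 0ℓ} (P? : Decidable P) →
      (∀ {x} → P x → P (σ x)) → (∀ {x} → P x → σ (σ x) ≡ x) → (∀ {x} → P x → σ x ≢ x) →
      count P? ≡ 2 ℕ.* count (P? ∩? lower?)
    count-involution-fixedPointFree P? σ-closed σ-involutive σx≢x = begin
      count P?                                              ≡⟨ count-involution P? σ-closed σ-involutive ⟩
      2 ℕ.* count (P? ∩? lower?) ℕ.+ count (P? ∩? fixed?)   ≡⟨ cong (2 ℕ.* count (P? ∩? lower?) ℕ.+_) no-fixed-points ⟩
      2 ℕ.* count (P? ∩? lower?) ℕ.+ 0                      ≡⟨ ℕP.+-identityʳ _ ⟩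
      2 ℕ.* count (P? ∩? lower?)                            ∎
      where
      open ≡-Reasoning
      no-fixed-points = empty⇒count≡0 (P? ∩? fixed?) (λ _ (Px , σx≡x) → σx≢x Px σx≡x)

-- The ring solver compares normal forms by computation, so its coefficients must be concrete:
-- integers, mapped into R.
module IntegerCoefficients (R : CommutativeRing 0ℓ 0ℓ) where

  open ℤ using (ℤ; +_; -[1+_])

  open CommutativeRing R hiding (refl; sym; trans; reflexive; setoid; isEquivalence)
  open CommutativeRing R using () renaming (refl to ≈-refl; sym to ≈-sym; trans to ≈-trans; reflexive to ≈-reflexive)
  open import Algebra.Properties.Semiring.Mult.TCOptimised semiring using (1+×; ×-homo-+; ×1-homo-*)
    renaming (_×_ to _·_)
  open import Algebra.Properties.Ring ring using (-1*x≈-x)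
  open import Algebra.Properties.AbelianGroup +-abelianGroup using (⁻¹-∙-comm)
  open import Algebra.Properties.Group +-group using (⁻¹-involutive; ε⁻¹≈ε)
  open import Algebra.Properties.CommutativeSemigroup +-commutativeSemigroup
    using () renaming (interchange to +-interchange)
  open import Algebra.Properties.CommutativeSemigroup *-commutativeSemigroup
    using () renaming (interchange to *-interchange)
  open import Relation.Binary.Reasoning.Setoid (CommutativeRing.setoid R)

  private
    ⟦_⟧ : ℤ → Carrier
    ⟦ + n ⟧      = n · 1#
    ⟦ -[1+ n ] ⟧ = - (suc n · 1#)

    n⁺ : ℕ → Carrier
    n⁺ n = n · 1#

    sign⟦_⟧ : Sign → Carrier
    sign⟦ Sign.+ ⟧ = 1#
    sign⟦ Sign.- ⟧ = - 1#

    sign-homo : ∀ s t → sign⟦ s Sign.* t ⟧ ≈ sign⟦ s ⟧ * sign⟦ t ⟧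
    sign-homo Sign.+ t      = ≈-sym (*-identityˡ _)
    sign-homo Sign.- Sign.+ = ≈-sym (*-identityʳ _)
    sign-homo Sign.- Sign.- = ≈-sym (begin
      - 1# * - 1#   ≈⟨ -1*x≈-x (- 1#) ⟩
      - - 1#        ≈⟨ ⁻¹-involutive 1# ⟩
      1#            ∎)

    ◃-homo : ∀ s n → ⟦ s ℤ.◃ n ⟧ ≈ sign⟦ s ⟧ * n⁺ n
    ◃-homo s       zero    = ≈-sym (zeroʳ _)
    ◃-homo Sign.+ (suc n)  = ≈-sym (*-identityˡ _)
    ◃-homo Sign.- (suc n)  = ≈-sym (-1*x≈-x _)

    sign-abs : ∀ i → ⟦ i ⟧ ≈ sign⟦ ℤ.sign i ⟧ * n⁺ ℤ.∣ i ∣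
    sign-abs (+ n)      = ≈-sym (*-identityˡ _)
    sign-abs -[1+ n ]   = ≈-sym (-1*x≈-x _)

    ⊖-homo : ∀ m n → ⟦ m ℤ.⊖ n ⟧ ≈ n⁺ m - n⁺ n
    ⊖-homo zero    zero    = ≈-sym (-‿inverseʳ 0#)
    ⊖-homo zero    (suc n) = ≈-sym (+-identityˡ _)
    ⊖-homo (suc m) zero    = ≈-sym (≈-trans (+-congˡ ε⁻¹≈ε) (+-identityʳ _))
    ⊖-homo (suc m) (suc n) = begin
      ⟦ suc m ℤ.⊖ suc n ⟧             ≡⟨ cong ⟦_⟧ (ℤP.[1+m]⊖[1+n]≡m⊖n m n) ⟩
      ⟦ m ℤ.⊖ n ⟧                     ≈⟨ ⊖-homo m n ⟩
      n⁺ m - n⁺ n                     ≈⟨ +-identityˡ _ ⟨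
      0# + (n⁺ m - n⁺ n)              ≈⟨ +-congʳ (-‿inverseʳ 1#) ⟨
      (1# - 1#) + (n⁺ m - n⁺ n)       ≈⟨ +-interchange 1# (- 1#) (n⁺ m) (- n⁺ n) ⟩
      (1# + n⁺ m) + (- 1# - n⁺ n)     ≈⟨ +-congˡ (⁻¹-∙-comm 1# (n⁺ n)) ⟩
      (1# + n⁺ m) - (1# + n⁺ n)       ≈⟨ +-cong (1+× m 1#) (-‿cong (1+× n 1#)) ⟨
      n⁺ (suc m) - n⁺ (suc n)         ∎

    +-homo : ∀ i j → ⟦ i ℤ.+ j ⟧ ≈ ⟦ i ⟧ + ⟦ j ⟧
    +-homo (+ m)     (+ n)     = ×-homo-+ 1# m n
    +-homo (+ m)     -[1+ n ]  = ⊖-homo m (suc n)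
    +-homo -[1+ m ]  (+ n)     = ≈-trans (⊖-homo n (suc m)) (+-comm _ _)
    +-homo -[1+ m ]  -[1+ n ]  = begin
      - n⁺ (suc (suc (m ℕ.+ n)))      ≡⟨ cong (λ k → - n⁺ (suc k)) (ℕP.+-suc m n) ⟨
      - n⁺ (suc m ℕ.+ suc n)          ≈⟨ -‿cong (×-homo-+ 1# (suc m) (suc n)) ⟩
      - (n⁺ (suc m) + n⁺ (suc n))     ≈⟨ ⁻¹-∙-comm _ _ ⟨
      - n⁺ (suc m) - n⁺ (suc n)       ∎

    *-homo : ∀ i j → ⟦ i ℤ.* j ⟧ ≈ ⟦ i ⟧ * ⟦ j ⟧
    *-homo i j = begin
      ⟦ i ℤ.* j ⟧                                   ≈⟨ ◃-homo (s Sign.* t) (ℤ.∣ i ∣ ℕ.* ℤ.∣ j ∣) ⟩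
      sign⟦ s Sign.* t ⟧ * n⁺ (ℤ.∣ i ∣ ℕ.* ℤ.∣ j ∣)  ≈⟨ *-cong (sign-homo s t) (×1-homo-* ℤ.∣ i ∣ ℤ.∣ j ∣) ⟩
      (sign⟦ s ⟧ * sign⟦ t ⟧) * (a * b)              ≈⟨ *-interchange _ _ _ _ ⟩
      (sign⟦ s ⟧ * a) * (sign⟦ t ⟧ * b)              ≈⟨ *-cong (sign-abs i) (sign-abs j) ⟨
      ⟦ i ⟧ * ⟦ j ⟧                                 ∎
      where
      s = ℤ.sign i
      t = ℤ.sign j
      a = n⁺ ℤ.∣ i ∣
      b = n⁺ ℤ.∣ j ∣

    -‿homo : ∀ i → ⟦ ℤ.- i ⟧ ≈ - ⟦ i ⟧
    -‿homo (+ zero)    = ≈-sym ε⁻¹≈ε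
    -‿homo (+ suc n)   = ≈-refl
    -‿homo -[1+ n ]    = ≈-sym (⁻¹-involutive _)

    homomorphism : ℤ.+-*-rawRing -Raw-AlmostCommutative⟶ fromCommutativeRing R
    homomorphism = record
      { ⟦_⟧ = ⟦_⟧ ; +-homo = +-homo ; *-homo = *-homo ; -‿homo = -‿homo
      ; 0-homo = ≈-refl ; 1-homo = ≈-refl }

    ⟦⟧-≟ : ∀ i j → Maybe (⟦ i ⟧ ≈ ⟦ j ⟧)
    ⟦⟧-≟ i j with i ℤP.≟ j
    ... | yes i≡j = just (≈-reflexive (cong ⟦_⟧ i≡j))
    ... | no _    = nothing

  open Algebra.Solver.Ring ℤ.+-*-rawRing (fromCommutativeRing R) homomorphism ⟦⟧-≟ public

module FieldProperties {q : ℕ} (𝔽 : FiniteField q) where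

  open FiniteField 𝔽

  commutativeRing : CommutativeRing 0ℓ 0ℓ
  commutativeRing = record { isCommutativeRing = isCommutativeRing }

  open CommutativeRing commutativeRing
    using (+-group; +-comm; +-identityˡ; +-identityʳ; -‿inverseˡ; -‿inverseʳ;
           *-comm; *-assoc; *-identityˡ; *-identityʳ; zeroˡ; zeroʳ)
  open import Algebra.Properties.Group +-group public
    using (⁻¹-involutive; ε⁻¹≈ε; x∙y⁻¹≈ε⇒x≈y; inverseˡ-unique; inverseʳ-unique)
    renaming (∙-cancelˡ to +-cancelˡ; ∙-cancelʳ to +-cancelʳ; identityʳ-unique to +-identityʳ-unique)
  open IntegerCoefficients commutativeRing public
  open ≡-Reasoning

  2# : Carrier
  2# = 1# + 1#

  one two three : ∀ {n} → Polynomial n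
  one   = con (ℤ.+ 1)
  two   = one :+ one
  three = two :+ one

  1≢0 : 1# ≢ 0#
  1≢0 1≡0 = 0≢1 (sym 1≡0)

  -‿nonzero : ∀ {x} → x ≢ 0# → - x ≢ 0#
  -‿nonzero {x} x≢0 -x≡0 = x≢0 (begin
    x     ≡⟨ ⁻¹-involutive x ⟨
    - - x ≡⟨ cong -_ -x≡0 ⟩
    - 0#  ≡⟨ ε⁻¹≈ε ⟩
    0#    ∎)

  ⁻¹-inverseˡ : ∀ {x} → x ≢ 0# → x ⁻¹ * x ≡ 1#
  ⁻¹-inverseˡ {x} x≢0 = trans (*-comm _ _) (⁻¹-inverse x x≢0)

  x⁻¹*[x*y]≡y : ∀ {x} y → x ≢ 0# → x ⁻¹ * (x * y) ≡ y
  x⁻¹*[x*y]≡y {x} y x≢0 = begin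
    x ⁻¹ * (x * y)   ≡⟨ *-assoc _ _ _ ⟨
    (x ⁻¹ * x) * y   ≡⟨ cong (_* y) (⁻¹-inverseˡ x≢0) ⟩
    1# * y           ≡⟨ *-identityˡ y ⟩
    y                ∎

  *-cancelˡ : ∀ {a x y} → a ≢ 0# → a * x ≡ a * y → x ≡ y
  *-cancelˡ {a} {x} {y} a≢0 ax≡ay = begin
    x                ≡⟨ x⁻¹*[x*y]≡y x a≢0 ⟨
    a ⁻¹ * (a * x)   ≡⟨ cong (a ⁻¹ *_) ax≡ay ⟩
    a ⁻¹ * (a * y)   ≡⟨ x⁻¹*[x*y]≡y y a≢0 ⟩
    y                ∎

  x*y≡0⇒y≡0 : ∀ {x y} → x * y ≡ 0# → x ≢ 0# → y ≡ 0#
  x*y≡0⇒y≡0 {x} xy≡0 x≢0 = *-cancelˡ x≢0 (trans xy≡0 (sym (zeroʳ x)))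

  *-nonzero : ∀ {x y} → x ≢ 0# → y ≢ 0# → x * y ≢ 0#
  *-nonzero x≢0 y≢0 xy≡0 = y≢0 (x*y≡0⇒y≡0 xy≡0 x≢0)

  ⁻¹-unique : ∀ {x y} → x * y ≡ 1# → y ≡ x ⁻¹
  ⁻¹-unique {x} {y} xy≡1 = *-cancelˡ x≢0 (trans xy≡1 (sym (⁻¹-inverse x x≢0)))
    where
    x≢0 : x ≢ 0#
    x≢0 x≡0 = 1≢0 (trans (sym xy≡1) (trans (cong (_* y) x≡0) (zeroˡ y)))

  ⁻¹-nonzero : ∀ {x} → x ≢ 0# → x ⁻¹ ≢ 0#
  ⁻¹-nonzero {x} x≢0 x⁻¹≡0 =
    1≢0 (trans (sym (⁻¹-inverse x x≢0)) (trans (cong (x *_) x⁻¹≡0) (zeroʳ x)))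

  ⁻¹-involutive′ : ∀ {x} → x ≢ 0# → x ⁻¹ ⁻¹ ≡ x
  ⁻¹-involutive′ x≢0 = sym (⁻¹-unique (⁻¹-inverseˡ x≢0))

  ⁻¹-injective : ∀ {x y} → x ≢ 0# → y ≢ 0# → x ⁻¹ ≡ y ⁻¹ → x ≡ y
  ⁻¹-injective x≢0 y≢0 x⁻¹≡y⁻¹ =
    trans (sym (⁻¹-involutive′ x≢0)) (trans (cong _⁻¹ x⁻¹≡y⁻¹) (⁻¹-involutive′ y≢0))

  ⁻¹-distrib-* : ∀ {x y} → x ≢ 0# → y ≢ 0# → (x * y) ⁻¹ ≡ x ⁻¹ * y ⁻¹
  ⁻¹-distrib-* {x} {y} x≢0 y≢0 = sym (⁻¹-unique (begin
    (x * y) * (x ⁻¹ * y ⁻¹)   ≡⟨ solve 4 (λ a b c d → (a :* b) :* (c :* d) := (a :* c) :* (b :* d))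
                                        refl x y (x ⁻¹) (y ⁻¹) ⟩
    (x * x ⁻¹) * (y * y ⁻¹)   ≡⟨ cong₂ _*_ (⁻¹-inverse x x≢0) (⁻¹-inverse y y≢0) ⟩
    1# * 1#                   ≡⟨ *-identityˡ 1# ⟩
    1#                        ∎))

  x-y≡0⇒x≡y : ∀ {x y} → x - y ≡ 0# → x ≡ y
  x-y≡0⇒x≡y = x∙y⁻¹≈ε⇒x≈y _ _

  x≢y⇒x-y≢0 : ∀ {x y} → x ≢ y → x - y ≢ 0#
  x≢y⇒x-y≢0 x≢y x-y≡0 = x≢y (x-y≡0⇒x≡y x-y≡0)

  1+x⁻¹≡[x+1]*x⁻¹ : ∀ {x} → x ≢ 0# → 1# + x ⁻¹ ≡ (x + 1#) * x ⁻¹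
  1+x⁻¹≡[x+1]*x⁻¹ {x} x≢0 = begin
    1# + x ⁻¹          ≡⟨ cong (_+ x ⁻¹) (⁻¹-inverse x x≢0) ⟨
    x * x ⁻¹ + x ⁻¹    ≡⟨ solve 2 (λ x y → x :* y :+ y := (x :+ one) :* y) refl x (x ⁻¹) ⟩
    (x + 1#) * x ⁻¹    ∎

  x*x≡0⇒x≡0 : ∀ {x} → x * x ≡ 0# → x ≡ 0#
  x*x≡0⇒x≡0 {x} x²≡0 with x ≟ 0#
  ... | yes x≡0 = x≡0
  ... | no  x≢0 = x*y≡0⇒y≡0 x²≡0 x≢0

  x*x≡y*y⇒y≡±x : ∀ {x y} → y * y ≡ x * x → y ≡ x ⊎ y ≡ - x
  x*x≡y*y⇒y≡±x {x} {y} yy≡xx with (y - x) ≟ 0#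
  ... | yes y-x≡0 = inj₁ (x-y≡0⇒x≡y y-x≡0)
  ... | no  y-x≢0 = inj₂ (x-y≡0⇒x≡y (trans (cong (y +_) (⁻¹-involutive x)) (x*y≡0⇒y≡0 product≡0 y-x≢0)))
    where
    product≡0 : (y - x) * (y + x) ≡ 0#
    product≡0 = begin
      (y - x) * (y + x) ≡⟨ solve 2 (λ x y → (y :- x) :* (y :+ x) := y :* y :- x :* x) refl x y ⟩
      y * y - x * x     ≡⟨ cong (_- x * x) yy≡xx ⟩
      x * x - x * x     ≡⟨ -‿inverseʳ (x * x) ⟩
      0#                ∎

  x⁻¹≡x⇒x≡±1 : ∀ {x} → x ≢ 0# → x ⁻¹ ≡ x → x ≡ 1# ⊎ x ≡ - 1#
  x⁻¹≡x⇒x≡±1 {x} x≢0 x⁻¹≡x = x*x≡y*y⇒y≡±x (begin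
    x * x       ≡⟨ cong (x *_) x⁻¹≡x ⟨
    x * x ⁻¹    ≡⟨ ⁻¹-inverse x x≢0 ⟩
    1#          ≡⟨ *-identityˡ 1# ⟨
    1# * 1#     ∎)

  squareRoot : Carrier → Carrier
  squareRoot s with isSquare? s
  ... | yes (r , _) = r
  ... | no _        = 0#

  squareRoot-square : ∀ {s} → IsSquare s → squareRoot s * squareRoot s ≡ s
  squareRoot-square {s} □s with isSquare? s
  ... | yes (r , r²≡s) = r²≡s
  ... | no ¬□s         = contradiction □s ¬□s

  Residue NonResidue : Carrier → Set
  Residue x    = x ≢ 0# × IsSquare x
  NonResidue x = x ≢ 0# × ¬ IsSquare x

  nonzero? : Decidable (λ x → x ≢ 0#)
  nonzero? x = ¬? (x ≟ 0#)

  residue? : Decidable Residue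
  residue? x = nonzero? x ×-dec isSquare? x

  nonResidue? : Decidable NonResidue
  nonResidue? x = nonzero? x ×-dec ¬? (isSquare? x)

  IsSquare-* : ∀ {x y} → IsSquare x → IsSquare y → IsSquare (x * y)
  IsSquare-* {x} {y} (r , r²≡x) (s , s²≡y) = r * s , (begin
    (r * s) * (r * s) ≡⟨ solve 2 (λ r s → (r :* s) :* (r :* s) := (r :* r) :* (s :* s)) refl r s ⟩
    (r * r) * (s * s) ≡⟨ cong₂ _*_ r²≡x s²≡y ⟩
    x * y             ∎)

  Residue-1 : Residue 1#
  Residue-1 = 1≢0 , 1# , *-identityˡ 1#

  Residue-* : ∀ {x y} → Residue x → Residue y → Residue (x * y)
  Residue-* (x≢0 , □x) (y≢0 , □y) = *-nonzero x≢0 y≢0 , IsSquare-* □x □y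

  square-root-nonzero : ∀ {x r} → x ≢ 0# → r * r ≡ x → r ≢ 0#
  square-root-nonzero {x} {r} x≢0 r²≡x r≡0 = x≢0 (trans (sym r²≡x) (trans (cong (_* r) r≡0) (zeroˡ r)))

  Residue-⁻¹ : ∀ {x} → Residue x → Residue (x ⁻¹)
  Residue-⁻¹ {x} (x≢0 , r , r²≡x) = ⁻¹-nonzero x≢0 , r ⁻¹ , (begin
    r ⁻¹ * r ⁻¹   ≡⟨ ⁻¹-distrib-* r≢0 r≢0 ⟨
    (r * r) ⁻¹    ≡⟨ cong _⁻¹ r²≡x ⟩
    x ⁻¹          ∎)
    where
    r≢0 = square-root-nonzero x≢0 r²≡x

  Residue*NonResidue : ∀ {x y} → Residue x → NonResidue y → NonResidue (x * y)
  Residue*NonResidue {x} {y} Rx@(x≢0 , _) (y≢0 , ¬□y) = *-nonzero x≢0 y≢0 , λ □xy →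
    ¬□y (subst IsSquare (x⁻¹*[x*y]≡y y x≢0) (IsSquare-* (proj₂ (Residue-⁻¹ Rx)) □xy))

  NonResidue*Residue : ∀ {x y} → NonResidue x → Residue y → NonResidue (x * y)
  NonResidue*Residue {x} {y} Nx Ry = subst NonResidue (*-comm y x) (Residue*NonResidue Ry Nx)

  NonResidue-⁻¹ : ∀ {x} → NonResidue x → NonResidue (x ⁻¹)
  NonResidue-⁻¹ {x} (x≢0 , ¬□x) = ⁻¹-nonzero x≢0 , λ □x⁻¹ →
    ¬□x (subst IsSquare (⁻¹-involutive′ x≢0) (proj₂ (Residue-⁻¹ (⁻¹-nonzero x≢0 , □x⁻¹))))

  η≡1⇒Residue : ∀ x → η x ≡ ℤ.+ 1 → Residue x × ηF x ≡ 1#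
  η≡1⇒Residue x ηx≡1 with x ≟ 0#
  η≡1⇒Residue x () | yes _
  ... | no x≢0 with isSquare? x
  ...   | yes □x = (x≢0 , □x) , refl
  η≡1⇒Residue x () | no _ | no _

  η≡-1⇒NonResidue : ∀ x → η x ≡ ℤ.-[1+ 0 ] → NonResidue x × ηF x ≡ - 1#
  η≡-1⇒NonResidue x ηx≡-1 with x ≟ 0#
  η≡-1⇒NonResidue x () | yes _
  ... | no x≢0 with isSquare? x
  η≡-1⇒NonResidue x () | no _ | yes _
  ...   | no ¬□x = (x≢0 , ¬□x) , refl

module FieldCounting {q : ℕ} (𝔽 : FiniteField q) where

  open FiniteField 𝔽
  open FieldProperties 𝔽
  open IsCommutativeRing isCommutativeRing
    using (+-assoc; +-comm; +-identityʳ; -‿inverseʳ; *-identityˡ; *-assoc)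
  open ≡-Reasoning

  elements : List Carrier
  elements = map elem (allFin q)

  index : Carrier → ℕ
  index x = toℕ (Inverse.to enum x)

  index-injective : ∀ {x y} → index x ≡ index y → x ≡ y
  index-injective {x} {y} ix≡iy = begin
    x                         ≡⟨ Inverse.strictlyInverseʳ enum x ⟨
    elem (Inverse.to enum x)  ≡⟨ cong elem (toℕ-injective ix≡iy) ⟩
    elem (Inverse.to enum y)  ≡⟨ Inverse.strictlyInverseʳ enum y ⟩
    y                         ∎

  private
    elem-injective : ∀ {i j} → elem i ≡ elem j → i ≡ j
    elem-injective {i} {j} eᵢ≡eⱼ = begin
      i                         ≡⟨ Inverse.strictlyInverseˡ enum i ⟨
      Inverse.to enum (elem i)  ≡⟨ cong (Inverse.to enum) eᵢ≡eⱼ ⟩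
      Inverse.to enum (elem j)  ≡⟨ Inverse.strictlyInverseˡ enum j ⟩
      j                         ∎

    ∈-elements : ∀ x → x ∈ elements
    ∈-elements x = subst (_∈ elements) (Inverse.strictlyInverseʳ enum x)
      (∈-map⁺ elem (∈-allFin (Inverse.to enum x)))

  open Counting _≟_ elements (Unique.map⁺ elem-injective (Unique.allFin⁺ q)) ∈-elements public

  count-all : count U? ≡ q
  count-all = begin
    length (filter U? elements) ≡⟨ cong length (filter-all U? (All.universal U-Universal elements)) ⟩
    length elements             ≡⟨ length-map elem (allFin q) ⟩
    length (allFin q)           ≡⟨ length-tabulate (λ i → i) ⟩
    q                           ∎

  count-nonzero : suc (count nonzero?) ≡ q
  count-nonzero = begin
    1 ℕ.+ count nonzero?
      ≡⟨ cong₂ ℕ._+_ (sym (count-singleton (U? ∩? (_≟ 0#)) (tt , refl) proj₂))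
                     (count-cong nonzero? (U? ∩? ∁? (_≟ 0#)) (tt ,_) proj₂) ⟩
    count (U? ∩? (_≟ 0#)) ℕ.+ count (U? ∩? ∁? (_≟ 0#)) ≡⟨ count-split U? (_≟ 0#) ⟨
    count U?                                          ≡⟨ count-all ⟩
    q                                                 ∎

  ResiduePair NonResiduePair : Carrier → Set
  ResiduePair x    = Residue x × Residue (x + 1#)
  NonResiduePair x = NonResidue x × NonResidue (x + 1#)

  residuePair? : Decidable ResiduePair
  residuePair? x = residue? x ×-dec residue? (x + 1#)

  nonResiduePair? : Decidable NonResiduePair
  nonResiduePair? x = nonResidue? x ×-dec nonResidue? (x + 1#)

  SameCharacter : Carrier → Set
  SameCharacter x = ResiduePair x ⊎ NonResiduePair x

  sameCharacter? : Decidable SameCharacter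
  sameCharacter? = residuePair? ∪? nonResiduePair?

  count-sameCharacter : count sameCharacter? ≡ count residuePair? ℕ.+ count nonResiduePair?
  count-sameCharacter = trans (count-split sameCharacter? residue?) (cong₂ ℕ._+_
    (count-cong (sameCharacter? ∩? residue?) residuePair?
      (λ { (inj₁ Rxx , _) → Rxx ; (inj₂ (Nx , _) , Rx) → contradiction (proj₂ Rx) (proj₂ Nx) })
      (λ Rxx → inj₁ Rxx , proj₁ Rxx))
    (count-cong (sameCharacter? ∩? ∁? residue?) nonResiduePair?
      (λ { (inj₂ Nxx , _) → Nxx ; (inj₁ Rxx , ¬Rx) → contradiction (proj₁ Rxx) ¬Rx })
      (λ Nxx@(Nx , _) → inj₂ Nxx , λ Rx → proj₂ Nx (proj₂ Rx))))

  module OddOrder (h : ℕ) (q≡1+2h : q ≡ suc (2 ℕ.* h)) where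

    -- If 2 = 0 then x ↦ x + 1 is a fixed-point-free involution of the whole field, so q would be even.
    2≢0 : 2# ≢ 0#
    2≢0 2≡0 = ℕP.even≢odd (count (U? ∩? lower?)) h (begin
      2 ℕ.* count (U? ∩? lower?)  ≡⟨ count-involution-fixedPointFree U? (λ _ → tt) (λ _ → x+1+1≡x _)
                                                                  (λ {x} _ x+1≡x → 1≢0 (+-identityʳ-unique x 1# x+1≡x)) ⟨
      count U?                    ≡⟨ count-all ⟩
      q                           ≡⟨ q≡1+2h ⟩
      suc (2 ℕ.* h)               ∎)
      where
      open Involution index index-injective (_+ 1#)
      x+1+1≡x : ∀ x → x + 1# + 1# ≡ x
      x+1+1≡x x = trans (+-assoc x 1# 1#) (trans (cong (x +_) 2≡0) (+-identityʳ x))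

    -x≢x : ∀ {x} → x ≢ 0# → - x ≢ x
    -x≢x {x} x≢0 -x≡x = x≢0 (x*y≡0⇒y≡0 (begin
      2# * x    ≡⟨ solve 1 (λ x → two :* x := x :+ x) refl x ⟩
      x + x     ≡⟨ cong (x +_) -x≡x ⟨
      x - x     ≡⟨ -‿inverseʳ x ⟩
      0#        ∎) 2≢0)

    private
      module Negation = Involution index index-injective -_

    canonical : Carrier → Carrier
    canonical y with index y ℕP.<? index (- y)
    ... | yes _ = y
    ... | no _  = - y

    canonical-square : ∀ y → canonical y * canonical y ≡ y * y
    canonical-square y with index y ℕP.<? index (- y)
    ... | yes _ = refl
    ... | no _  = solve 1 (λ y → (:- y) :* (:- y) := y :* y) refl y

    canonical-lower : ∀ {y} → y ≢ 0# → canonical y ≢ 0# × Negation.Lower (canonical y)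
    canonical-lower {y} y≢0 with index y ℕP.<? index (- y)
    ... | yes y<-y = y≢0 , y<-y
    ... | no  y≮-y = -‿nonzero y≢0 , subst (λ z → index (- y) < index z) (sym (⁻¹-involutive y))
          (ℕP.≤∧≢⇒< (ℕP.≮⇒≥ y≮-y) (λ i-y≡iy → -x≢x y≢0 (index-injective i-y≡iy)))

    count-lower≡count-residues : count (nonzero? ∩? Negation.lower?) ≡ count residue?
    count-lower≡count-residues = count-bijective (nonzero? ∩? Negation.lower?) residue?
      (λ x → x * x) (λ s → canonical (squareRoot s))
      (λ {x} (x≢0 , _) → *-nonzero x≢0 x≢0 , x , refl)
      square-injective
      (λ (s≢0 , □s) → canonical-lower (square-root-nonzero s≢0 (squareRoot-square □s)))
      (λ {s} {t} (_ , □s) (_ , □t) c≡c → begin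
        s                                                     ≡⟨ squareRoot-square □s ⟨
        squareRoot s * squareRoot s                           ≡⟨ canonical-square _ ⟨
        canonical (squareRoot s) * canonical (squareRoot s)   ≡⟨ cong (λ z → z * z) c≡c ⟩
        canonical (squareRoot t) * canonical (squareRoot t)   ≡⟨ canonical-square _ ⟩
        squareRoot t * squareRoot t                           ≡⟨ squareRoot-square □t ⟩
        t                                                     ∎)
      where
      square-injective : ∀ {x y} → x ≢ 0# × Negation.Lower x → y ≢ 0# × Negation.Lower y → x * x ≡ y * y → x ≡ y
      square-injective {x} {y} (_ , x<-x) (_ , y<-y) x²≡y² with x*x≡y*y⇒y≡±x (sym x²≡y²)
      ... | inj₁ y≡x  = sym y≡x
      ... | inj₂ y≡-x = contradiction x<-x (ℕP.<⇒≯ (subst (λ z → index (- x) < index z) (⁻¹-involutive x)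
                                                     (subst (λ z → index z < index (- z)) y≡-x y<-y)))

    count-residues : count residue? ≡ h
    count-residues = ℕP.*-cancelˡ-≡ _ _ 2 (ℕP.suc-injective (begin
      suc (2 ℕ.* count residue?)                                   ≡⟨ cong (λ n → suc (2 ℕ.* n)) count-lower≡count-residues ⟨
      suc (2 ℕ.* count (nonzero? ∩? Negation.lower?))              ≡⟨ cong suc nonzero≡2*lower ⟨
      suc (count nonzero?)                                         ≡⟨ count-nonzero ⟩
      q                                                            ≡⟨ q≡1+2h ⟩
      suc (2 ℕ.* h)                                                ∎))
      where
      nonzero≡2*lower : count nonzero? ≡ 2 ℕ.* count (nonzero? ∩? Negation.lower?)
      nonzero≡2*lower = Negation.count-involution-fixedPointFree nonzero? -‿nonzero (λ _ → ⁻¹-involutive _) -x≢x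

    count-nonResidues : count nonResidue? ≡ h
    count-nonResidues = trans (ℕP.+-cancelˡ-≡ h _ (h ℕ.+ 0) (begin
      h ℕ.+ count nonResidue?                  ≡⟨ cong (ℕ._+ count nonResidue?) count-residues ⟨
      count residue? ℕ.+ count nonResidue?     ≡⟨ count-split nonzero? isSquare? ⟨
      count nonzero?                           ≡⟨ ℕP.suc-injective (trans count-nonzero q≡1+2h) ⟩
      2 ℕ.* h                                  ∎)) (ℕP.+-identityʳ h)

    -- Multiplication by a non-residue injects the h residues into the h non-residues, hence hits every one.
    NonResidue*NonResidue : ∀ {x y} → NonResidue x → NonResidue y → IsSquare (x * y)
    NonResidue*NonResidue {x} {y} Nx@(x≢0 , _) Ny with
      count-≤-injective⇒surjective residue? nonResidue? (x *_) (NonResidue*Residue Nx)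
        (λ _ _ → *-cancelˡ x≢0) (ℕP.≤-reflexive (trans count-nonResidues (sym count-residues))) Ny
    ... | s , (_ , r , r²≡s) , xs≡y = x * r , (begin
      (x * r) * (x * r)   ≡⟨ solve 2 (λ x r → (x :* r) :* (x :* r) := x :* (x :* (r :* r))) refl x r ⟩
      x * (x * (r * r))   ≡⟨ cong (λ z → x * (x * z)) r²≡s ⟩
      x * (x * s)         ≡⟨ cong (x *_) xs≡y ⟩
      x * y               ∎)

    -- x ↦ 1 + 1/x = (x + 1)/x is a residue exactly when x and x + 1 have the same character.
    count-sameCharacter≡count-residues≢1 : count sameCharacter? ≡ count (residue? ∩? ∁? (_≟ 1#))
    count-sameCharacter≡count-residues≢1 = count-bijective sameCharacter? (residue? ∩? ∁? (_≟ 1#))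
      (λ x → 1# + x ⁻¹) (λ u → (u - 1#) ⁻¹)
      (λ Sx → to-residue Sx , λ 1+x⁻¹≡1 → ⁻¹-nonzero (nonzero Sx) (+-identityʳ-unique 1# _ 1+x⁻¹≡1))
      (λ Sx Sy 1+x⁻¹≡1+y⁻¹ → ⁻¹-injective (nonzero Sx) (nonzero Sy) (+-cancelˡ 1# _ _ 1+x⁻¹≡1+y⁻¹))
      (λ { {u} (Ru , u≢1) → from-residue Ru u≢1 (isSquare? (u - 1#)) })
      (λ (_ , u≢1) (_ , v≢1) → +-cancelʳ (- 1#) _ _ ∘ ⁻¹-injective (x≢y⇒x-y≢0 u≢1) (x≢y⇒x-y≢0 v≢1))
      where
      nonzero : ∀ {x} → SameCharacter x → x ≢ 0#
      nonzero (inj₁ ((x≢0 , _) , _)) = x≢0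
      nonzero (inj₂ ((x≢0 , _) , _)) = x≢0
      to-residue : ∀ {x} → SameCharacter x → Residue (1# + x ⁻¹)
      to-residue (inj₁ (Rx@(x≢0 , _) , Rx+1)) =
        subst Residue (sym (1+x⁻¹≡[x+1]*x⁻¹ x≢0)) (Residue-* Rx+1 (Residue-⁻¹ Rx))
      to-residue (inj₂ (Nx@(x≢0 , _) , Nx+1)) =
        subst Residue (sym (1+x⁻¹≡[x+1]*x⁻¹ x≢0))
          (*-nonzero (proj₁ Nx+1) (⁻¹-nonzero x≢0) , NonResidue*NonResidue Nx+1 (NonResidue-⁻¹ Nx))
      u*w⁻¹≡w⁻¹+1 : ∀ {u} → u ≢ 1# → u * (u - 1#) ⁻¹ ≡ (u - 1#) ⁻¹ + 1#
      u*w⁻¹≡w⁻¹+1 {u} u≢1 = begin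
        u * w ⁻¹              ≡⟨ cong (_* w ⁻¹) (solve 1 (λ u → u := (u :- one) :+ one) refl u) ⟩
        (w + 1#) * w ⁻¹       ≡⟨ 1+x⁻¹≡[x+1]*x⁻¹ (x≢y⇒x-y≢0 u≢1) ⟨
        1# + w ⁻¹             ≡⟨ +-comm 1# _ ⟩
        w ⁻¹ + 1#             ∎
        where w = u - 1#
      from-residue : ∀ {u} → Residue u → u ≢ 1# → Dec (IsSquare (u - 1#)) → SameCharacter ((u - 1#) ⁻¹)
      from-residue Ru u≢1 (yes □w) = inj₁ (Rx , subst Residue (u*w⁻¹≡w⁻¹+1 u≢1) (Residue-* Ru Rx))
        where Rx = Residue-⁻¹ (x≢y⇒x-y≢0 u≢1 , □w)
      from-residue Ru u≢1 (no ¬□w) = inj₂ (Nx , subst NonResidue (u*w⁻¹≡w⁻¹+1 u≢1) (Residue*NonResidue Ru Nx))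
        where Nx = NonResidue-⁻¹ (x≢y⇒x-y≢0 u≢1 , ¬□w)

    count-equalCharacterPairs : suc (count residuePair? ℕ.+ count nonResiduePair?) ≡ h
    count-equalCharacterPairs = begin
      suc (count residuePair? ℕ.+ count nonResiduePair?)
        ≡⟨ cong suc (trans (sym count-sameCharacter) count-sameCharacter≡count-residues≢1) ⟩
      suc (count (residue? ∩? ∁? (_≟ 1#)))
        ≡⟨ cong (ℕ._+ count (residue? ∩? ∁? (_≟ 1#)))
                (count-singleton (residue? ∩? (_≟ 1#)) (Residue-1 , refl) proj₂) ⟨
      count (residue? ∩? (_≟ 1#)) ℕ.+ count (residue? ∩? ∁? (_≟ 1#))
        ≡⟨ count-split residue? (_≟ 1#) ⟨
      count residue?
        ≡⟨ count-residues ⟩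
      h ∎

    module OddHalfOrder (j : ℕ) (h≡1+2j : h ≡ suc (2 ℕ.* j)) where

      private
        module Inversion = Involution index index-injective _⁻¹

      1⁻¹≡1 : 1# ⁻¹ ≡ 1#
      1⁻¹≡1 = sym (⁻¹-unique (*-identityˡ 1#))

      -1⁻¹≡-1 : (- 1#) ⁻¹ ≡ - 1#
      -1⁻¹≡-1 = sym (⁻¹-unique (solve 0 (:- one :* :- one := one) refl))

      1≢-1 : 1# ≢ - 1#
      1≢-1 1≡-1 = 2≢0 (trans (cong (1# +_) 1≡-1) (-‿inverseʳ 1#))

      -- Inversion pairs up the residues; its fixed points ±1 would both be residues, making h even.
      -1-nonResidue : NonResidue (- 1#)
      -1-nonResidue = -‿nonzero 1≢0 , λ □-1 → ℕP.even≢odd (suc c) j (begin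
        2 ℕ.* suc c              ≡⟨ ℕP.*-suc 2 c ⟩
        2 ℕ.+ 2 ℕ.* c            ≡⟨ ℕP.+-comm 2 _ ⟩
        2 ℕ.* c ℕ.+ 2            ≡⟨ cong (2 ℕ.* c ℕ.+_) (two-fixed-points □-1) ⟨
        2 ℕ.* c ℕ.+ count (residue? ∩? Inversion.fixed?)
                                 ≡⟨ Inversion.count-involution residue? Residue-⁻¹ (λ (x≢0 , _) → ⁻¹-involutive′ x≢0) ⟨
        count residue?           ≡⟨ count-residues ⟩
        h                        ≡⟨ h≡1+2j ⟩
        suc (2 ℕ.* j)            ∎)
        where
        c = count (residue? ∩? Inversion.lower?)
        two-fixed-points : IsSquare (- 1#) → count (residue? ∩? Inversion.fixed?) ≡ 2
        two-fixed-points □-1 = trans (count-split (residue? ∩? Inversion.fixed?) (_≟ 1#)) (cong₂ ℕ._+_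
          (count-singleton _ ((Residue-1 , 1⁻¹≡1) , refl) proj₂)
          (count-singleton _ (((-‿nonzero 1≢0 , □-1) , -1⁻¹≡-1) , λ -1≡1 → 1≢-1 (sym -1≡1))
            (λ (((x≢0 , _) , x⁻¹≡x) , x≢1) → [ (λ x≡1 → contradiction x≡1 x≢1) , (λ x≡-1 → x≡-1) ]′
                                                (x⁻¹≡x⇒x≡±1 x≢0 x⁻¹≡x))))

      -- x ↦ -(x + 1) swaps x and x + 1 up to the factor -1, a non-residue.
      count-residuePairs≡count-nonResiduePairs : count residuePair? ≡ count nonResiduePair?
      count-residuePairs≡count-nonResiduePairs = count-bijective residuePair? nonResiduePair? reflect reflect
        (λ (Rx , Rx+1) → subst NonResidue (-1*x≡-x _) (NonResidue*Residue -1-nonResidue Rx+1)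
                       , subst NonResidue (reflect+1 _) (NonResidue*Residue -1-nonResidue Rx))
        (λ _ _ → reflect-injective)
        (λ (Nx , Nx+1) → subst Residue (-1*x≡-x _) (nonResidue*nonResidue Nx+1)
                       , subst Residue (reflect+1 _) (nonResidue*nonResidue Nx))
        (λ _ _ → reflect-injective)
        where
        reflect : Carrier → Carrier
        reflect x = - (x + 1#)
        -1*x≡-x : ∀ x → - 1# * x ≡ - x
        -1*x≡-x = solve 1 (λ x → :- one :* x := :- x) refl
        reflect+1 : ∀ x → - 1# * x ≡ reflect x + 1#
        reflect+1 = solve 1 (λ x → :- one :* x := :- (x :+ one) :+ one) refl
        reflect-injective : ∀ {x y} → reflect x ≡ reflect y → x ≡ y
        reflect-injective {x} {y} rx≡ry = begin
          x                     ≡⟨ solve 1 (λ x → x := :- (:- (x :+ one) :+ one)) refl x ⟩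
          - (reflect x + 1#)    ≡⟨ cong (λ z → - (z + 1#)) rx≡ry ⟩
          - (reflect y + 1#)    ≡⟨ solve 1 (λ y → :- (:- (y :+ one) :+ one) := y) refl y ⟩
          y                     ∎
        nonResidue*nonResidue : ∀ {x} → NonResidue x → Residue (- 1# * x)
        nonResidue*nonResidue Nx = *-nonzero (proj₁ -1-nonResidue) (proj₁ Nx) , NonResidue*NonResidue -1-nonResidue Nx

      count-residuePairs : count residuePair? ≡ j
      count-residuePairs = ℕP.*-cancelˡ-≡ _ _ 2 (ℕP.suc-injective (begin
        suc (2 ℕ.* count residuePair?)
          ≡⟨ cong (λ n → suc (count residuePair? ℕ.+ n)) (ℕP.+-identityʳ _) ⟩
        suc (count residuePair? ℕ.+ count residuePair?)
          ≡⟨ cong (λ n → suc (count residuePair? ℕ.+ n)) count-residuePairs≡count-nonResiduePairs ⟩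
        suc (count residuePair? ℕ.+ count nonResiduePair?)    ≡⟨ count-equalCharacterPairs ⟩
        h                                                     ≡⟨ h≡1+2j ⟩
        suc (2 ℕ.* j)                                         ∎))

      -- Inversion acts on the j residue pairs; its only possible fixed point is 1, a pair iff 2 is a residue.
      2-isSquare : ∀ k → j ≡ suc (2 ℕ.* k) → IsSquare 2#
      2-isSquare k j≡1+2k with isSquare? 2#
      ... | yes □2 = □2
      ... | no ¬□2 = contradiction (begin
        2 ℕ.* count (residuePair? ∩? Inversion.lower?)
          ≡⟨ Inversion.count-involution-fixedPointFree residuePair? inverse-pair
               (λ ((x≢0 , _) , _) → ⁻¹-involutive′ x≢0) x⁻¹≢x ⟨
        count residuePair?   ≡⟨ count-residuePairs ⟩
        j                    ≡⟨ j≡1+2k ⟩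
        suc (2 ℕ.* k)        ∎) (ℕP.even≢odd (count (residuePair? ∩? Inversion.lower?)) k)
        where
        inverse-pair : ∀ {x} → ResiduePair x → ResiduePair (x ⁻¹)
        inverse-pair {x} (Rx@(x≢0 , _) , Rx+1) = Residue-⁻¹ Rx ,
          subst Residue (trans (sym (1+x⁻¹≡[x+1]*x⁻¹ x≢0)) (+-comm 1# _)) (Residue-* Rx+1 (Residue-⁻¹ Rx))
        x⁻¹≢x : ∀ {x} → ResiduePair x → x ⁻¹ ≢ x
        x⁻¹≢x ((x≢0 , □x) , Rx+1) x⁻¹≡x =
          [ (λ x≡1 → ¬□2 (subst (λ z → IsSquare (z + 1#)) x≡1 (proj₂ Rx+1)))
          , (λ x≡-1 → proj₂ -1-nonResidue (subst IsSquare x≡-1 □x)) ]′ (x⁻¹≡x⇒x≡±1 x≢0 x⁻¹≡x)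

module Disjointness {q : ℕ} (𝔽 : FiniteField q) where

  open FiniteField 𝔽
  open FieldProperties 𝔽
  open IsCommutativeRing isCommutativeRing using (+-comm; +-identityʳ; -‿inverseˡ; -‿inverseʳ; zeroʳ)
  open ≡-Reasoning

  4# : Carrier
  4# = 2# + 2#

  -- F (x + 1) - F x on C₀₁ and on C₁₀, with c standing for 1/3.
  Δ₀₁ Δ₁₀ : Carrier → Carrier → Carrier
  Δ₀₁ c x = (x + 1#) * (x + 1#) * (1# + c * - 1#) - x * x * (1# + c * 1#)
  Δ₁₀ c y = (y + 1#) * (y + 1#) * (1# + c * 1#) - y * y * (1# + c * - 1#)

  conic : Carrier → Carrier → Carrier
  conic x y = x * x - 2# * x + y * y + 4# * y + 1#

  private
    Δ₀₁ᵖ Δ₁₀ᵖ conicᵖ : ∀ {n} → Polynomial n → Polynomial n → Polynomial n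
    Δ₀₁ᵖ c x = (x :+ one) :* (x :+ one) :* (one :+ c :* :- one) :- x :* x :* (one :+ c :* one)
    Δ₁₀ᵖ c y = (y :+ one) :* (y :+ one) :* (one :+ c :* one) :- y :* y :* (one :+ c :* :- one)
    conicᵖ x y = x :* x :- two :* x :+ y :* y :+ (two :+ two) :* y :+ one

  module _ (2≢0 : 2# ≢ 0#) where

    Δ₀₁≡Δ₁₀⇒conic≡0 : ∀ {c x y} → 3# * c ≡ 1# → Δ₀₁ c x ≡ Δ₁₀ c y → conic x y ≡ 0#
    Δ₀₁≡Δ₁₀⇒conic≡0 {c} {x} {y} 3c≡1 Δ₀₁≡Δ₁₀ = x*y≡0⇒y≡0 (begin
      2# * conic x y                                  ≡⟨ identity x y c ⟩
      - (3# * (Δ₀₁ c x - Δ₁₀ c y)) - (3# * c - 1#) * K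
        ≡⟨ cong₂ (λ d e → - (3# * d) - e * K) (trans (cong (_- Δ₁₀ c y) Δ₀₁≡Δ₁₀) (-‿inverseʳ _))
                                              (trans (cong (_- 1#) 3c≡1) (-‿inverseʳ 1#)) ⟩
      - (3# * 0#) - 0# * K                            ≡⟨ solve 1 (λ k → :- (three :* 0ᵖ) :- 0ᵖ :* k := 0ᵖ) refl K ⟩
      0#                                              ∎) 2≢0
      where
      0ᵖ : Polynomial 1
      0ᵖ = con (ℤ.+ 0)
      K = (x + 1#) * (x + 1#) + x * x + (y + 1#) * (y + 1#) + y * y
      -- with c = 1/3 the second summand vanishes and 3 (Δ₀₁ - Δ₁₀) = - 2 conic
      identity : ∀ x y c → 2# * conic x y ≡ - (3# * (Δ₀₁ c x - Δ₁₀ c y))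
                   - (3# * c - 1#) * ((x + 1#) * (x + 1#) + x * x + (y + 1#) * (y + 1#) + y * y)
      identity = solve 3 (λ x y c → two :* conicᵖ x y :=
        :- (three :* (Δ₀₁ᵖ c x :- Δ₁₀ᵖ c y))
        :- (three :* c :- one) :* ((x :+ one) :* (x :+ one) :+ x :* x :+ (y :+ one) :* (y :+ one) :+ y :* y)) refl

  conic≡0⇒[x-1]² : ∀ {x y} → conic x y ≡ 0# → (x - 1#) * (x - 1#) ≡ - (y * (y + 4#))
  conic≡0⇒[x-1]² {x} {y} conic≡0 = begin
    (x - 1#) * (x - 1#)               ≡⟨ solve 2 (λ x y → (x :- one) :* (x :- one) :=
                                              :- (y :* (y :+ (two :+ two))) :+ conicᵖ x y) refl x y ⟩
    - (y * (y + 4#)) + conic x y      ≡⟨ cong (- (y * (y + 4#)) +_) conic≡0 ⟩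
    - (y * (y + 4#)) + 0#             ≡⟨ +-identityʳ _ ⟩
    - (y * (y + 4#))                  ∎

  conic≡0⇒[x+y+3]² : ∀ {x y} → conic x y ≡ 0# → (x + y + 3#) * (x + y + 3#) ≡ 2# * (x + 1#) * (y + 4#)
  conic≡0⇒[x+y+3]² {x} {y} conic≡0 = begin
    (x + y + 3#) * (x + y + 3#)             ≡⟨ solve 2 (λ x y → (x :+ y :+ three) :* (x :+ y :+ three) :=
                                                    two :* (x :+ one) :* (y :+ (two :+ two)) :+ conicᵖ x y) refl x y ⟩
    2# * (x + 1#) * (y + 4#) + conic x y    ≡⟨ cong (2# * (x + 1#) * (y + 4#) +_) conic≡0 ⟩
    2# * (x + 1#) * (y + 4#) + 0#           ≡⟨ +-identityʳ _ ⟩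
    2# * (x + 1#) * (y + 4#)                ∎

  C₀₁⇒F-difference : ∀ {x} → C₀₁ x → F (x + 1#) - F x ≡ Δ₀₁ (3# ⁻¹) x
  C₀₁⇒F-difference {x} (ηx≡1 , ηx+1≡-1) =
    cong₂ (λ u v → (x + 1#) * (x + 1#) * (1# + 3# ⁻¹ * u) - x * x * (1# + 3# ⁻¹ * v))
      (proj₂ (η≡-1⇒NonResidue (x + 1#) ηx+1≡-1)) (proj₂ (η≡1⇒Residue x ηx≡1))

  C₁₀⇒F-difference : ∀ {y} → C₁₀ y → F (y + 1#) - F y ≡ Δ₁₀ (3# ⁻¹) y
  C₁₀⇒F-difference {y} (ηy≡-1 , ηy+1≡1) =
    cong₂ (λ u v → (y + 1#) * (y + 1#) * (1# + 3# ⁻¹ * u) - y * y * (1# + 3# ⁻¹ * v))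
      (proj₂ (η≡1⇒Residue (y + 1#) ηy+1≡1)) (proj₂ (η≡-1⇒NonResidue y ηy≡-1))

  #A₀₁≡0⊎#A₁₀≡0 : ∀ {b} → (∀ {x y} → A₀₁ b x → A₁₀ b y → ⊥) → #A₀₁ b ≡ 0 ⊎ #A₁₀ b ≡ 0
  #A₀₁≡0⊎#A₁₀≡0 {b} disjoint with any? (λ i → A₀₁? b (elem i))
  ... | yes (_ , x∈A₀₁) = inj₂ (length-filter-none _ (λ _ y∈A₁₀ → disjoint x∈A₀₁ y∈A₁₀) (allFin q))
  ... | no ∄x∈A₀₁       = inj₁ (length-filter-none _ (λ i x∈A₀₁ → ∄x∈A₀₁ (i , x∈A₀₁)) (allFin q))

  module _ (□2 : IsSquare 2#) (-1-nonResidue : NonResidue (- 1#))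
           (NonResidue*NonResidue : ∀ {x y} → NonResidue x → NonResidue y → IsSquare (x * y)) where

    2≢0 : 2# ≢ 0#
    2≢0 2≡0 = proj₂ -1-nonResidue (subst IsSquare (inverseʳ-unique 1# 1# 2≡0) (proj₂ Residue-1))

    3≢0 : 3# ≢ 0#
    3≢0 3≡0 = proj₂ -1-nonResidue (subst IsSquare (inverseˡ-unique 2# 1# 3≡0) □2)

    A₀₁×A₁₀⇒⊥ : ∀ {b x y} → A₀₁ b x → A₁₀ b y → ⊥
    A₀₁×A₁₀⇒⊥ {b} {x} {y} (x∈C₀₁ , Δx≡b) (y∈C₁₀ , Δy≡b) = by-cases ((y + 4#) ≟ 0#)
      where
      conic≡0 : conic x y ≡ 0#
      conic≡0 = Δ₀₁≡Δ₁₀⇒conic≡0 2≢0 (⁻¹-inverse 3# 3≢0)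
        (trans (sym (C₀₁⇒F-difference x∈C₀₁)) (trans Δx≡b (trans (sym Δy≡b) (C₁₀⇒F-difference y∈C₁₀))))
      N[x+1] : NonResidue (x + 1#)
      N[x+1] = proj₁ (η≡-1⇒NonResidue (x + 1#) (proj₂ x∈C₀₁))
      N[y] : NonResidue y
      N[y] = proj₁ (η≡-1⇒NonResidue y (proj₁ y∈C₁₀))
      by-cases : Dec (y + 4# ≡ 0#) → ⊥
      by-cases (yes y+4≡0) = proj₂ N[x+1] (subst (λ z → IsSquare (z + 1#)) (sym x≡1) □2)
        where
        x≡1 : x ≡ 1#
        x≡1 = x-y≡0⇒x≡y (x*x≡0⇒x≡0 (begin
          (x - 1#) * (x - 1#)   ≡⟨ conic≡0⇒[x-1]² conic≡0 ⟩
          - (y * (y + 4#))      ≡⟨ cong (λ z → - (y * z)) y+4≡0 ⟩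
          - (y * 0#)            ≡⟨ cong -_ (zeroʳ y) ⟩
          - 0#                  ≡⟨ ε⁻¹≈ε ⟩
          0#                    ∎))
      by-cases (no y+4≢0) = proj₂ N[rhs] (Z , Z²≡rhs)
        where
        Z   = (x - 1#) * (x + y + 3#)
        rhs = (- 1# * y) * (x + 1#) * (2# * ((y + 4#) * (y + 4#)))
        Z²≡rhs : Z * Z ≡ rhs
        Z²≡rhs = begin
          Z * Z
            ≡⟨ solve 2 (λ a b → (a :* b) :* (a :* b) := (a :* a) :* (b :* b)) refl (x - 1#) (x + y + 3#) ⟩
          ((x - 1#) * (x - 1#)) * ((x + y + 3#) * (x + y + 3#))
            ≡⟨ cong₂ _*_ (conic≡0⇒[x-1]² conic≡0) (conic≡0⇒[x+y+3]² conic≡0) ⟩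
          - (y * (y + 4#)) * (2# * (x + 1#) * (y + 4#))
            ≡⟨ solve 3 (λ x y w → :- (y :* w) :* (two :* (x :+ one) :* w)
                               := (:- one :* y) :* (x :+ one) :* (two :* (w :* w))) refl x y (y + 4#) ⟩
          rhs ∎
        R[-y] : Residue (- 1# * y)
        R[-y] = *-nonzero (proj₁ -1-nonResidue) (proj₁ N[y]) , NonResidue*NonResidue -1-nonResidue N[y]
        N[rhs] : NonResidue rhs
        N[rhs] = NonResidue*Residue (Residue*NonResidue R[-y] N[x+1])
          (Residue-* (2≢0 , □2) (*-nonzero y+4≢0 y+4≢0 , y + 4# , refl))


7+8m≡1+2[1+2[1+2m]] : ∀ m → 7 ℕ.+ m ℕ.* 8 ≡ suc (2 ℕ.* suc (2 ℕ.* suc (2 ℕ.* m)))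
7+8m≡1+2[1+2[1+2m]] = solve-∀

lemma18 : (q : ℕ) → IsOddPrimePower q → q % 8 ≡ 7 →
    (𝔽 : FiniteField q) → (b : FiniteField.Carrier 𝔽) →
    FiniteField.#A₀₁ 𝔽 b ≡ 0 ⊎ FiniteField.#A₁₀ 𝔽 b ≡ 0
lemma18 q _ q%8≡7 𝔽 b =
  #A₀₁≡0⊎#A₁₀≡0 (A₀₁×A₁₀⇒⊥ (2-isSquare m refl) -1-nonResidue NonResidue*NonResidue)
  where
  m = q / 8
  q≡8m+7 : q ≡ suc (2 ℕ.* suc (2 ℕ.* suc (2 ℕ.* m)))
  q≡8m+7 = begin
    q              ≡⟨ m≡m%n+[m/n]*n q 8 ⟩
    q % 8 ℕ.+ m ℕ.* 8 ≡⟨ cong (ℕ._+ m ℕ.* 8) q%8≡7 ⟩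
    7 ℕ.+ m ℕ.* 8  ≡⟨ 7+8m≡1+2[1+2[1+2m]] m ⟩
    suc (2 ℕ.* suc (2 ℕ.* suc (2 ℕ.* m))) ∎
    where open ≡-Reasoning
  open FieldCounting 𝔽
  open OddOrder (suc (2 ℕ.* suc (2 ℕ.* m))) q≡8m+7
  open OddHalfOrder (suc (2 ℕ.* m)) refl
  open Disjointness 𝔽
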